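{- For every $n\geq 3$, Player 1 has a winning strategy for $\texttt{RAV}(D_n,\{r,s\})$, where $D_n=\langle r,s\mid r^n=s^2=rsrs=e\rangle$ is the dihedral group of order $2n$.
   Context: Game $\texttt{RAV}(G,S)$: $G$ is a finite group and $S$ a generating set with $e\notin S$. Two players alternate turns, Player 1 first, starting from the empty word $w_0$. On turn $n$ the current player chooses $s_n\in S\cup S^{ -1}$, subject to $s_n\neq s_{n-1}^{ -1}$ when $n>1$, and forms $w_n=w_{n-1}s_n$. If $w_n$ represents the same element of $G$ as some $w_k$ with $0\le k<n$, the player who formed $w_n$ loses. If a player has no legal move, that player loses. -}

module Defs where

open import Data.Nat using (ℕ; zero; suc; _+_; _∸_; _%_)
open import Data.Bool using (Bool; true; false; if_then_else_; _xor_)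
open import Data.Product using (_×_; _,_)
open import Data.Sum using (_⊎_)
open import Data.Maybe using (Maybe; just; nothing)
open import Data.Unit using (⊤)
open import Data.List using (List; []; _∷_; map)
open import Data.List.Membership.Propositional using (_∈_; _∉_)
open import Relation.Binary.PropositionalEquality using (_≡_)
open import Relation.Nullary using (¬_)

-- The game RAV(G,S), for a group G given by its operations on a carrier
-- A (equality of group elements is _≡_, so the carrier representation
-- must be canonical), and a list S of generators.
--
-- A position is: the current element `cur` (= value of w_n), the list
-- `hist` of elements represented by the earlier words w_0,…,w_{n-1},
-- and the last move played (nothing at the start).
-- `Win cur hist last`  : the player about to move has a winning strategy.
-- `Lose cur hist last` : the player about to move has no way to avoid
--                        losing against a correct opponent.
-- A move to an already-visited element loses immediately for the mover;
-- a player with no legal move loses.  Since the game is finite, the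
-- inductive (well-founded) notion of winning strategy is the standard one.

module RAV {A : Set} (_∙_ : A → A → A) (_⁻¹ : A → A) (S : List A) where

  IsMove : A → Set
  IsMove m = m ∈ S ⊎ m ∈ map _⁻¹ S

  Legal : Maybe A → A → Set
  Legal nothing  m = ⊤
  Legal (just p) m = ¬ (m ≡ p ⁻¹)

  mutual
    data Win (cur : A) (hist : List A) (last : Maybe A) : Set where
      win : (m : A) → IsMove m → Legal last m →
            (cur ∙ m) ∉ (cur ∷ hist) →
            Lose (cur ∙ m) (cur ∷ hist) (just m) →
            Win cur hist last

    data Lose (cur : A) (hist : List A) (last : Maybe A) : Set where
      lose : ((m : A) → IsMove m → Legal last m →
              (cur ∙ m) ∉ (cur ∷ hist) →
              Win (cur ∙ m) (cur ∷ hist) (just m)) →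
             Lose cur hist last

  Player1Wins : A → Set
  Player1Wins e = Win e [] nothing

-- Element (k , b) with 0 ≤ k < n represents r^k s^(if b then 1 else 0).
-- Using s r^c = r^(-c) s:
--   r^a s^b · r^c s^d = r^(a + (-1)^b c) s^(b+d).

modN : ℕ → ℕ → ℕ
modN zero    k = k
modN (suc m) k = k % suc m

D : ℕ → Set
D n = ℕ × Bool

D-mul : (n : ℕ) → D n → D n → D n
D-mul n (a , b) (c , d) = modN n (a + (if b then n ∸ c else c)) , (b xor d)

D-inv : (n : ℕ) → D n → D n
D-inv n (a , false) = modN n (n ∸ a) , false
D-inv n (a , true)  = a , true

D-e : (n : ℕ) → D n
D-e n = 0 , false

D-r : (n : ℕ) → D n
D-r n = modN n 1 , false

D-s : (n : ℕ) → D n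
D-s n = 0 , true

Player1WinsDihedral : ℕ → Set
Player1WinsDihedral n =
  RAV.Player1Wins (D-mul n) (D-inv n) (D-r n ∷ D-s n ∷ []) (D-e n)

-- Player 1 opens with s and answers every move of the opponent with s. Because s² = e,
-- the set of visited elements is then always a union of pairs {g, gs}: when the opponent
-- reaches a fresh element g, the element gs is fresh as well, and s is a legal reply since
-- the opponent's move m was not s⁻¹. Every round uses up fresh elements of the finite group,
-- so eventually the opponent runs out of moves that avoid a repetition.
module Submission where

open import Defs
open import Data.Nat using (ℕ; suc; _+_; _∸_; _%_; _≤_; _<_; z≤n; s≤s)
open import Data.Nat.Properties using (≤-refl; ≤-pred; m≤n⇒m≤1+n; <-≤-trans; +-identityʳ)
import Data.Nat.Properties as Nat
open import Data.Nat.DivMod using (m<n⇒m%n≡m; [m+n]%n≡m%n; m%n<n)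
open import Data.Bool using (true; false; not; if_then_else_)
open import Data.Bool.Properties using (not-involutive; not-¬)
import Data.Bool.Properties as Bool
open import Data.Product using (_,_; proj₂)
open import Data.Product.Properties using (≡-dec)
open import Data.Sum using (inj₁)
open import Data.Maybe using (just)
open import Data.Unit using (tt)
open import Data.List using (List; []; _∷_; upTo; cartesianProduct)
open import Data.List.Relation.Unary.Any using (here; there)
open import Data.List.Membership.Propositional using (_∈_; _∉_)
open import Data.List.Membership.Propositional.Properties using (∈-upTo⁺; ∈-cartesianProduct⁺)
open import Data.List.Relation.Binary.Subset.Propositional using (_⊆_)
open import Function using (_∘_)
open import Relation.Binary.Definitions using (DecidableEquality)
open import Relation.Binary.PropositionalEquality using (_≡_; _≢_; refl; sym; trans; cong; subst; module ≡-Reasoning)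
open import Relation.Nullary using (yes; no; contradiction)

module Missing {A : Set} (_≟_ : DecidableEquality A) where

  open import Data.List.Membership.DecPropositional _≟_ using (_∈?_)

  missing : List A → List A → ℕ
  missing V []       = 0
  missing V (x ∷ xs) with x ∈? V
  ... | yes _ = missing V xs
  ... | no  _ = suc (missing V xs)

  missing-antitone : ∀ {V W} xs → V ⊆ W → missing W xs ≤ missing V xs
  missing-antitone []       V⊆W = z≤n
  missing-antitone {V} {W} (x ∷ xs) V⊆W with x ∈? V | x ∈? W
  ... | yes x∈V | no  x∉W = contradiction (V⊆W x∈V) x∉W
  ... | yes _   | yes _   = missing-antitone xs V⊆W
  ... | no  _   | yes _   = m≤n⇒m≤1+n (missing-antitone xs V⊆W)
  ... | no  _   | no  _   = s≤s (missing-antitone xs V⊆W)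

  missing-strictlyAntitone : ∀ {V W y} xs → V ⊆ W → y ∈ xs → y ∉ V → y ∈ W →
                             missing W xs < missing V xs
  missing-strictlyAntitone {V} {W} (x ∷ xs) V⊆W y∈xs y∉V y∈W with x ∈? V | x ∈? W | y∈xs
  ... | yes x∈V | no  x∉W | _         = contradiction (V⊆W x∈V) x∉W
  ... | _       | no  x∉W | here refl = contradiction y∈W x∉W
  ... | yes x∈V | _       | here refl = contradiction x∈V y∉V
  ... | no  _   | yes _   | here refl = s≤s (missing-antitone xs V⊆W)
  ... | yes _   | yes _   | there y∈ = missing-strictlyAntitone xs V⊆W y∈ y∉V y∈W
  ... | no  _   | yes _   | there y∈ = m≤n⇒m≤1+n (missing-strictlyAntitone xs V⊆W y∈ y∉V y∈W)
  ... | no  _   | no  _   | there y∈ = s≤s (missing-strictlyAntitone xs V⊆W y∈ y∉V y∈W)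

-- Group elements need not be represented canonically; `Reduced` singles out the canonical
-- representatives, which include every product.
module InvolutionStrategy
  {A : Set} (_∙_ : A → A → A) (_⁻¹ : A → A) (S : List A) (_≟_ : DecidableEquality A)
  (Reduced : A → Set) (∙-reduced : ∀ g m → Reduced (g ∙ m))
  (elements : List A) (reduced⇒∈ : ∀ {g} → Reduced g → g ∈ elements)
  (s : A) (s-isMove : RAV.IsMove _∙_ _⁻¹ S s)
  (∙s-involutive : ∀ {g} → Reduced g → (g ∙ s) ∙ s ≡ g)
  (∙s-noFixedPoint : ∀ {g} → Reduced g → g ∙ s ≢ g)
  (⁻¹-swap : ∀ {m} → s ≡ m ⁻¹ → m ≡ s ⁻¹)
  where

  open RAV _∙_ _⁻¹ S
  open Missing _≟_

  ClosedUnder∙s : List A → Set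
  ClosedUnder∙s V = ∀ {g} → g ∈ V → g ∙ s ∈ V

  ∙s-fresh : ∀ {g V} → Reduced g → ClosedUnder∙s V → g ∉ V → g ∙ s ∉ g ∷ V
  ∙s-fresh rg closed g∉V (here gs≡g)    = ∙s-noFixedPoint rg gs≡g
  ∙s-fresh rg closed g∉V (there gs∈V) =
    g∉V (subst (_∈ _) (∙s-involutive rg) (closed gs∈V))

  closedUnder∙s-extend : ∀ {g V} → Reduced g → ClosedUnder∙s V →
                         ClosedUnder∙s (g ∙ s ∷ g ∷ V)
  closedUnder∙s-extend rg closed (here refl)          =
    there (here (∙s-involutive rg))
  closedUnder∙s-extend rg closed (there (here refl))  = here refl
  closedUnder∙s-extend rg closed (there (there h∈V)) = there (there (closed h∈V))

  missing-decreases : ∀ {g V} → Reduced g → g ∉ V →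
                      missing (g ∙ s ∷ g ∷ V) elements < missing V elements
  missing-decreases rg g∉V =
    missing-strictlyAntitone elements (there ∘ there) (reduced⇒∈ rg) g∉V (there (here refl))

  mutual
    playS : ∀ fuel {g V last} → Reduced g → Legal last s → ClosedUnder∙s V → g ∉ V →
            missing V elements ≤ fuel → Win g V last
    playS fuel rg legal closed g∉V bound =
      win s s-isMove legal (∙s-fresh rg closed g∉V)
        (opponentLoses fuel (closedUnder∙s-extend rg closed)
          (<-≤-trans (missing-decreases rg g∉V) bound))

    opponentLoses : ∀ fuel {g V} → ClosedUnder∙s (g ∷ V) →
                    missing (g ∷ V) elements < fuel → Lose g V (just s)
    opponentLoses (suc fuel) {g} closed bound =
      lose λ m _ m≢s⁻¹ fresh →
        playS fuel (∙-reduced g m) (m≢s⁻¹ ∘ ⁻¹-swap) closed fresh (≤-pred bound)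

  player1Wins : ∀ {e} → Reduced e → Player1Wins e
  player1Wins re = playS _ re tt (λ ()) (λ ()) ≤-refl

module Dihedral (n : ℕ) where

  N : ℕ
  N = suc n

  Reduced : D N → Set
  Reduced (y , _) = y < N

  elements : List (D N)
  elements = cartesianProduct (upTo N) (false ∷ true ∷ [])

  reduced⇒∈ : ∀ {g} → Reduced g → g ∈ elements
  reduced⇒∈ {y , false} y<N = ∈-cartesianProduct⁺ (∈-upTo⁺ y<N) (here refl)
  reduced⇒∈ {y , true}  y<N = ∈-cartesianProduct⁺ (∈-upTo⁺ y<N) (there (here refl))

  ∙-reduced : ∀ g m → Reduced (D-mul N g m)
  ∙-reduced (a , b) (c , _) = m%n<n (a + (if b then N ∸ c else c)) N

  ∙s-flips : ∀ {y} b → y < N → D-mul N (y , b) (D-s N) ≡ (y , not b)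
  ∙s-flips {y} false y<N = cong (_, true) (begin
    (y + 0) % N ≡⟨ cong (_% N) (+-identityʳ y) ⟩
    y % N       ≡⟨ m<n⇒m%n≡m y<N ⟩
    y           ∎)
    where open ≡-Reasoning
  ∙s-flips {y} true y<N = cong (_, false) (begin
    (y + N) % N ≡⟨ [m+n]%n≡m%n y N ⟩
    y % N       ≡⟨ m<n⇒m%n≡m y<N ⟩
    y           ∎)
    where open ≡-Reasoning

  ∙s-involutive : ∀ {g} → Reduced g → D-mul N (D-mul N g (D-s N)) (D-s N) ≡ g
  ∙s-involutive {y , b} y<N = begin
    D-mul N (D-mul N (y , b) (D-s N)) (D-s N) ≡⟨ cong (λ h → D-mul N h (D-s N)) (∙s-flips b y<N) ⟩
    D-mul N (y , not b) (D-s N)               ≡⟨ ∙s-flips (not b) y<N ⟩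
    (y , not (not b))                         ≡⟨ cong (y ,_) (not-involutive b) ⟩
    (y , b)                                   ∎
    where open ≡-Reasoning

  ∙s-noFixedPoint : ∀ {g} → Reduced g → D-mul N g (D-s N) ≢ g
  ∙s-noFixedPoint {y , b} y<N gs≡g =
    not-¬ refl (cong proj₂ (trans (sym gs≡g) (∙s-flips b y<N)))

  ⁻¹-swap : ∀ {m} → D-s N ≡ D-inv N m → m ≡ D-inv N (D-s N)
  ⁻¹-swap {_ , true} refl = refl

  player1Wins : Player1WinsDihedral N
  player1Wins = InvolutionStrategy.player1Wins
    (D-mul N) (D-inv N) (D-r N ∷ D-s N ∷ []) (≡-dec Nat._≟_ Bool._≟_)
    Reduced ∙-reduced elements reduced⇒∈
    (D-s N) (inj₁ (there (here refl))) ∙s-involutive ∙s-noFixedPoint ⁻¹-swap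
    {D-e N} (s≤s z≤n)

-- The strategy wins in D_n for every n ≥ 1.
theorem3p8 : (n : ℕ) → 3 ≤ n → Player1WinsDihedral n
theorem3p8 (suc n) _ = Dihedral.player1Wins n
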